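{- Let $X$ be an infinite set of variables and let $\langle N',*'\rangle$ be the pargoid defined below. There are no $\mathbf t,\mathbf u\in N'$ such that $\langle N',*',\mathbf t,\mathbf u\rangle$ is a partial combinatory algebra.
   Context: Terms $T_C(X)$ are built from variables in $X$ and constant symbols $s,k$ by binary application (juxtaposition, left-associative). CL is the rewrite system with rules $sxyz\to xz(yz)$ and $kxy\to x$; it is confluent, so normal forms are unique. $N$ is the set of CL-normal forms; for $\mathbf m,\mathbf n\in N$, $\mathbf m*\mathbf n$ is the normal form of $\mathbf{mn}$ if it exists, undefined otherwise. Put $\mathbf i:=skk$, $\omega:=s\mathbf i\mathbf i$, $\mathbf d:=s(k\omega)(k\omega)$, $L:=\{\mathbf n\in N\mid \mathbf n*x\text{ defined for every variable }x\in X\text{ not occurring in }\mathbf n\}$, $N':=L\cup\{\mathbf d\}$, and for $a,b\in N'$ let $a*'b:=a*b$ if $a*b$ is defined and lies in $N'$, undefined otherwise. A partial combinatory algebra is a pargoid $\langle A,\cdot\rangle$ (nonempty set with partial binary operation, left-associative products, a product defined only if its factors are) with elements $S,K\in A$ such that for all $x,y,z\in A$: (0) $Sxy$ is defined; (1) $Sxyz\simeq xz(yz)$, where $\simeq$ means "if either side is defined, both are defined and equal"; (2) $Kxy$ is defined and equals $x$. -}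

module Defs where

open import Data.Nat using (ℕ)
open import Data.Product using (Σ; ∃; _×_; _,_)
open import Data.Sum using (_⊎_)
open import Relation.Nullary using (¬_)
open import Relation.Binary.PropositionalEquality using (_≡_)
open import Relation.Binary.Construct.Closure.ReflexiveTransitive using (Star)
open import Function.Definitions using (Injective)

-- Generic notions: pargoids given by the graph of a partial operation on
-- a subset  P  of a type  A  (elements compared by _≡_), products of
-- elements, Kleene equality, partial combinatory algebras.

module _ {A : Set} (App : A → A → A → Set) where

  data Exp : Set where
    ⌜_⌝ : A → Exp
    _∙_ : Exp → Exp → Exp

  infixl 9 _∙_

  data Eval : Exp → A → Set where
    ev-const : ∀ a → Eval ⌜ a ⌝ a
    ev-app   : ∀ {e₁ e₂ a b c} → Eval e₁ a → Eval e₂ b → App a b c → Eval (e₁ ∙ e₂) c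

  Defined : Exp → Set
  Defined e = ∃ λ v → Eval e v

  -- Kleene equality: if either side is defined, both are and are equal
  -- (for a functional App this is "same values").
  _≃_ : Exp → Exp → Set
  e₁ ≃ e₂ = ∀ v → (Eval e₁ v → Eval e₂ v) × (Eval e₂ v → Eval e₁ v)

  record IsPCA (P : A → Set) (S K : A) : Set where
    field
      S∈ : P S
      K∈ : P K
      ax0 : ∀ x y → P x → P y → Defined (⌜ S ⌝ ∙ ⌜ x ⌝ ∙ ⌜ y ⌝)
      ax1 : ∀ x y z → P x → P y → P z →
            (⌜ S ⌝ ∙ ⌜ x ⌝ ∙ ⌜ y ⌝ ∙ ⌜ z ⌝) ≃ (⌜ x ⌝ ∙ ⌜ z ⌝ ∙ (⌜ y ⌝ ∙ ⌜ z ⌝))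
      ax2 : ∀ x y → P x → P y → Eval (⌜ K ⌝ ∙ ⌜ x ⌝ ∙ ⌜ y ⌝) x

module _ {X : Set} where

  data Term : Set where
    var : X → Term
    s k : Term
    _·_ : Term → Term → Term

  infixl 9 _·_

  data _⟶_ : Term → Term → Set where
    s-rule : ∀ x y z → (s · x · y · z) ⟶ (x · z · (y · z))
    k-rule : ∀ x y → (k · x · y) ⟶ x
    appˡ : ∀ {t t′} u → t ⟶ t′ → (t · u) ⟶ (t′ · u)
    appʳ : ∀ t {u u′} → u ⟶ u′ → (t · u) ⟶ (t · u′)

  _⟶*_ : Term → Term → Set
  _⟶*_ = Star _⟶_

  Normal : Term → Set
  Normal t = ∀ t′ → ¬ (t ⟶ t′)

  data Occurs (x : X) : Term → Set where
    here : Occurs x (var x)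
    inˡ : ∀ {t} u → Occurs x t → Occurs x (t · u)
    inʳ : ∀ t {u} → Occurs x u → Occurs x (t · u)

  _*_⇓_ : Term → Term → Term → Set
  m * n ⇓ p = ((m · n) ⟶* p) × Normal p

  𝐢 ω 𝐝 : Term
  𝐢 = s · k · k
  ω = s · 𝐢 · 𝐢
  𝐝 = s · (k · ω) · (k · ω)

  InL : Term → Set
  InL n = Normal n × (∀ (x : X) → ¬ Occurs x n → ∃ λ p → n * var x ⇓ p)

  InN′ : Term → Set
  InN′ t = InL t ⊎ t ≡ 𝐝

  _*′_⇓_ : Term → Term → Term → Set
  a *′ b ⇓ c = (a * b ⇓ c) × InN′ c

Infinite : Set → Set
Infinite X = Σ (ℕ → X) Injective′
  where Injective′ : (ℕ → X) → Set
        Injective′ f = Injective _≡_ _≡_ f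

-- Suppose t were the S of a partial combinatory algebra on N′. Variables and
-- their neutral products lie in N′, so axiom (1) at fresh variables a, b, c
-- forces t a b c ⟶* a c (b c), and substituting gives t P Q R ⟶* P R (Q R)
-- for all terms. Axiom (0) makes t 𝐢 𝐝 normalise to some e ∈ N′, while
-- t 𝐢 𝐝 Z ⟶* Z (𝐝 Z) and 𝐝 Z ⟶* ω ω diverges. If e = 𝐝, take Z = k k: then
-- t 𝐢 𝐝 (k k) reaches the normal form k but also 𝐝 (k k), which has none. If
-- e ∈ L, take Z a variable c ∉ e: e c has a normal form but is a reduct of
-- t 𝐢 𝐝 c, as is c (𝐝 c), which has none. Both contradict confluence.
-- Fresh variables exist only under double negation (equality on X need not be
-- decidable), which is harmless since the goal is ⊥.

module Submission where

open import Defs renaming (_⟶_ to infix 4 _⟶_; _⟶*_ to infix 4 _⟶*_)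
open import Data.Empty using (⊥; ⊥-elim)
open import Data.List using (List; []; _∷_; _++_)
open import Data.List.Membership.Propositional using (_∈_)
open import Data.List.Membership.Propositional.Properties using (∈-++⁺ˡ; ∈-++⁺ʳ)
open import Data.List.Relation.Unary.Any using (here; there)
open import Data.Nat using (ℕ; suc; _+_)
open import Data.Nat.Properties using (+-cancelˡ-≡; suc-injective; m+1+n≢m)
open import Data.Product using (Σ; ∃; _×_; _,_; -,_; proj₂)
open import Data.Sum using (inj₁; inj₂)
open import Function.Definitions using (Injective)
open import Relation.Binary.Construct.Closure.ReflexiveTransitive using (ε; _◅_; _◅◅_; gmap)
open import Relation.Binary.PropositionalEquality using (_≡_; _≢_; refl; sym; trans; cong₂)
open import Relation.Nullary using (¬_; yes; no)
open import Relation.Nullary.Decidable using (¬¬-excluded-middle)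

finite-list-misses-injection : {A : Set} (l : List A) {g : ℕ → A} →
                               Injective _≡_ _≡_ g → ¬ (∀ n → ¬ ¬ g n ∈ l)
finite-list-misses-injection [] _ all∈ = all∈ 0 λ ()
finite-list-misses-injection (x ∷ l) {g} g-inj all∈ =
  ¬¬-excluded-middle {A = ∃ λ n → g n ≡ x} λ where
    (yes (n₀ , gn₀≡x)) →
      finite-list-misses-injection l {λ n → g (n₀ + suc n)}
        (λ e → suc-injective (+-cancelˡ-≡ n₀ _ _ (g-inj e)))
        (λ n → drop-head (λ e → m+1+n≢m n₀ (g-inj (trans e (sym gn₀≡x))))
                         (all∈ (n₀ + suc n)))
    (no no-hit) →
      finite-list-misses-injection l g-inj (λ n → drop-head (λ e → no-hit (n , e)) (all∈ n))
  where
    drop-head : ∀ {y} → y ≢ x → ¬ ¬ y ∈ x ∷ l → ¬ ¬ y ∈ l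
    drop-head y≢x ¬¬y∈ y∉l = ¬¬y∈ λ where
      (here y≡x) → y≢x y≡x
      (there y∈l) → y∉l y∈l

module _ {X : Set} where

  private
    Tm : Set
    Tm = Term {X}

    App : Tm → Tm → Tm → Set
    App = _*′_⇓_

    variable
      x : X
      M M′ N N′ P A B C V W : Tm

  vars : Tm → List X
  vars (var x) = x ∷ []
  vars s = []
  vars k = []
  vars (M · N) = vars M ++ vars N

  Occurs⇒∈vars : Occurs x M → x ∈ vars M
  Occurs⇒∈vars here = here refl
  Occurs⇒∈vars (inˡ _ o) = ∈-++⁺ˡ (Occurs⇒∈vars o)
  Occurs⇒∈vars (inʳ M o) = ∈-++⁺ʳ (vars M) (Occurs⇒∈vars o)

  fresh : Infinite X → (M : Tm) → ¬ ¬ (∃ λ x → ¬ Occurs x M)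
  fresh (f , f-inj) M no-fresh =
    finite-list-misses-injection (vars M) f-inj
      (λ n fn∉ → no-fresh (f n , λ o → fn∉ (Occurs⇒∈vars o)))

  ⟶*-appˡ : ∀ N → M ⟶* M′ → M · N ⟶* M′ · N
  ⟶*-appˡ N = gmap (λ M → M · N) (appˡ N)

  ⟶*-appʳ : ∀ M → N ⟶* N′ → M · N ⟶* M · N′
  ⟶*-appʳ M = gmap (λ N → M · N) (appʳ M)

  ⟶*-app : M ⟶* M′ → N ⟶* N′ → M · N ⟶* M′ · N′
  ⟶*-app {M′ = M′} {N} p q = ⟶*-appˡ N p ◅◅ ⟶*-appʳ M′ q

  𝐢-⟶* : (M : Tm) → 𝐢 · M ⟶* M
  𝐢-⟶* M = s-rule k k M ◅ k-rule M (k · M) ◅ ε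

  -- Confluence via Takahashi's complete developments

  infix 4 _⇉_

  data _⇉_ : Tm → Tm → Set where
    var : var x ⇉ var x
    s : s ⇉ s
    k : k ⇉ k
    app : M ⇉ M′ → N ⇉ N′ → M · N ⇉ M′ · N′
    s-rule : {x x′ y y′ z z′ : Tm} → x ⇉ x′ → y ⇉ y′ → z ⇉ z′ →
             s · x · y · z ⇉ x′ · z′ · (y′ · z′)
    k-rule : {x x′ y : Tm} → x ⇉ x′ → k · x · y ⇉ x′

  ⇉-refl : ∀ M → M ⇉ M
  ⇉-refl (var x) = var
  ⇉-refl s = s
  ⇉-refl k = k
  ⇉-refl (M · N) = app (⇉-refl M) (⇉-refl N)

  ⟶⇒⇉ : M ⟶ N → M ⇉ N
  ⟶⇒⇉ (s-rule x y z) = s-rule (⇉-refl x) (⇉-refl y) (⇉-refl z)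
  ⟶⇒⇉ (k-rule x y) = k-rule (⇉-refl x)
  ⟶⇒⇉ (appˡ N r) = app (⟶⇒⇉ r) (⇉-refl N)
  ⟶⇒⇉ (appʳ M r) = app (⇉-refl M) (⟶⇒⇉ r)

  ⇉⇒⟶* : M ⇉ N → M ⟶* N
  ⇉⇒⟶* var = ε
  ⇉⇒⟶* s = ε
  ⇉⇒⟶* k = ε
  ⇉⇒⟶* (app p q) = ⟶*-app (⇉⇒⟶* p) (⇉⇒⟶* q)
  ⇉⇒⟶* (s-rule {x} {y = y} {z = z} p q r) =
    s-rule x y z ◅ ⟶*-app (⟶*-app (⇉⇒⟶* p) (⇉⇒⟶* r)) (⟶*-app (⇉⇒⟶* q) (⇉⇒⟶* r))
  ⇉⇒⟶* (k-rule {x} {y = y} p) = k-rule x y ◅ ⇉⇒⟶* p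

  dev : Tm → Tm
  dev (s · x · y · z) = dev x · dev z · (dev y · dev z)
  dev (k · x · y) = dev x
  dev (M · N) = dev M · dev N
  dev M = M

  -- The clauses follow the case tree of dev: an application must be split until
  -- it is known whether it is a redex.
  ⇉-dev : M ⇉ N → N ⇉ dev M
  ⇉-dev var = var
  ⇉-dev s = s
  ⇉-dev k = k
  ⇉-dev (s-rule p q r) = app (app (⇉-dev p) (⇉-dev r)) (app (⇉-dev q) (⇉-dev r))
  ⇉-dev (k-rule p) = ⇉-dev p
  ⇉-dev (app var q) = app var (⇉-dev q)
  ⇉-dev (app s q) = app s (⇉-dev q)
  ⇉-dev (app k q) = app k (⇉-dev q)
  ⇉-dev (app p@(s-rule _ _ _) q) = app (⇉-dev p) (⇉-dev q)
  ⇉-dev (app p@(k-rule _) q) = app (⇉-dev p) (⇉-dev q)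
  ⇉-dev (app (app k p) q) = k-rule (⇉-dev p)
  ⇉-dev (app p@(app var _) q) = app (⇉-dev p) (⇉-dev q)
  ⇉-dev (app p@(app s _) q) = app (⇉-dev p) (⇉-dev q)
  ⇉-dev (app p@(app (s-rule _ _ _) _) q) = app (⇉-dev p) (⇉-dev q)
  ⇉-dev (app p@(app (k-rule _) _) q) = app (⇉-dev p) (⇉-dev q)
  ⇉-dev (app (app (app s p) q) r) = s-rule (⇉-dev p) (⇉-dev q) (⇉-dev r)
  ⇉-dev (app p@(app (app var _) _) q) = app (⇉-dev p) (⇉-dev q)
  ⇉-dev (app p@(app (app k _) _) q) = app (⇉-dev p) (⇉-dev q)
  ⇉-dev (app p@(app (app (app _ _) _) _) q) = app (⇉-dev p) (⇉-dev q)
  ⇉-dev (app p@(app (app (s-rule _ _ _) _) _) q) = app (⇉-dev p) (⇉-dev q)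
  ⇉-dev (app p@(app (app (k-rule _) _) _) q) = app (⇉-dev p) (⇉-dev q)

  ⇉-strip : M ⇉ A → M ⟶* B → ∃ λ C → A ⟶* C × B ⇉ C
  ⇉-strip {A = A} p ε = A , ε , p
  ⇉-strip p (r ◅ rs) with ⇉-strip (⇉-dev (⟶⇒⇉ r)) rs
  ... | C , devM⟶*C , B⇉C = C , ⇉⇒⟶* (⇉-dev p) ◅◅ devM⟶*C , B⇉C

  ⟶*-confluent : M ⟶* A → M ⟶* B → ∃ λ C → A ⟶* C × B ⟶* C
  ⟶*-confluent {B = B} ε q = B , q , ε
  ⟶*-confluent (r ◅ rs) q with ⇉-strip (⟶⇒⇉ r) q
  ... | C₁ , M₁⟶*C₁ , B⇉C₁ with ⟶*-confluent rs M₁⟶*C₁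
  ... | C , A⟶*C , C₁⟶*C = C , A⟶*C , ⇉⇒⟶* B⇉C₁ ◅◅ C₁⟶*C

  Normal-⟶*⇒≡ : Normal W → W ⟶* V → W ≡ V
  Normal-⟶*⇒≡ _ ε = refl
  Normal-⟶*⇒≡ W-normal (r ◅ _) = ⊥-elim (W-normal _ r)

  ⟶*-normal-form : M ⟶* A → M ⟶* W → Normal W → A ⟶* W
  ⟶*-normal-form M⟶*A M⟶*W W-normal with ⟶*-confluent M⟶*A M⟶*W
  ... | C , A⟶*C , W⟶*C with Normal-⟶*⇒≡ W-normal W⟶*C
  ... | refl = A⟶*C

  data Ne : Tm → Set
  data NF : Tm → Set

  data Ne where
    var : Ne (var x)
    app : Ne M → NF N → Ne (M · N)

  data NF where
    ne : Ne M → NF M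
    s₀ : NF s
    s₁ : NF M → NF (s · M)
    s₂ : NF M → NF N → NF (s · M · N)
    k₀ : NF k
    k₁ : NF M → NF (k · M)

  Ne⇒Normal : Ne M → Normal M
  NF⇒Normal : NF M → Normal M

  Ne⇒Normal var _ ()
  Ne⇒Normal (app (app (app () _) _) _) _ (s-rule _ _ _)
  Ne⇒Normal (app M-ne _) _ (appˡ _ r) = Ne⇒Normal M-ne _ r
  Ne⇒Normal (app _ N-nf) _ (appʳ _ r) = NF⇒Normal N-nf _ r

  NF⇒Normal (ne M-ne) = Ne⇒Normal M-ne
  NF⇒Normal s₀ _ ()
  NF⇒Normal (s₁ M-nf) _ (appʳ _ r) = NF⇒Normal M-nf _ r
  NF⇒Normal (s₂ M-nf _) _ (appˡ _ (appʳ _ r)) = NF⇒Normal M-nf _ r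
  NF⇒Normal (s₂ _ N-nf) _ (appʳ _ r) = NF⇒Normal N-nf _ r
  NF⇒Normal k₀ _ ()
  NF⇒Normal (k₁ M-nf) _ (appʳ _ r) = NF⇒Normal M-nf _ r

  NF-𝐢 : NF 𝐢
  NF-𝐢 = s₂ k₀ k₀

  NF-ω : NF ω
  NF-ω = s₂ NF-𝐢 NF-𝐢

  NF-𝐝 : NF 𝐝
  NF-𝐝 = s₂ (k₁ NF-ω) (k₁ NF-ω)

  Ne⇒InL : Ne M → InL M
  Ne⇒InL M-ne = NF⇒Normal (ne M-ne) ,
                λ x _ → -, ε , NF⇒Normal (ne (app M-ne (ne var)))

  𝐢∈L : InL {X} 𝐢
  𝐢∈L = NF⇒Normal NF-𝐢 , λ x _ → var x , 𝐢-⟶* (var x) , NF⇒Normal (ne var)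

  Ne-*′ : Ne M → NF N → App M N (M · N)
  Ne-*′ M-ne N-nf = (ε , NF⇒Normal (ne MN-ne)) , inj₁ (Ne⇒InL MN-ne)
    where MN-ne = app M-ne N-nf

  -- ω-Like terms are ω wrapped in 𝐢- and k-redexes; an application of two of
  -- them only ever reduces to another such application (ω N ⟶ 𝐢 N (𝐢 N)).
  data ω-Like : Tm → Set where
    is-ω : ω-Like ω
    𝐢· : ω-Like M → ω-Like (𝐢 · M)
    k· : ω-Like M → ω-Like (k · M · N)

  data Divergent : Tm → Set where
    ω-Like· : ω-Like M → ω-Like N → Divergent (M · N)
    𝐝· : Divergent (𝐝 · M)
    var· : Divergent M → Divergent (var x · M)

  ω-Like-⟶ : ω-Like M → M ⟶ M′ → ω-Like M′
  ω-Like-⟶ is-ω r = ⊥-elim (NF⇒Normal NF-ω _ r)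
  ω-Like-⟶ (𝐢· M-ω) (s-rule _ _ _) = k· M-ω
  ω-Like-⟶ (𝐢· M-ω) (appˡ _ r) = ⊥-elim (NF⇒Normal NF-𝐢 _ r)
  ω-Like-⟶ (𝐢· M-ω) (appʳ _ r) = 𝐢· (ω-Like-⟶ M-ω r)
  ω-Like-⟶ (k· M-ω) (k-rule _ _) = M-ω
  ω-Like-⟶ (k· M-ω) (appˡ _ (appʳ _ r)) = k· (ω-Like-⟶ M-ω r)
  ω-Like-⟶ (k· M-ω) (appʳ _ r) = k· M-ω

  Divergent-⟶ : Divergent M → M ⟶ M′ → Divergent M′
  Divergent-⟶ (ω-Like· is-ω N-ω) (s-rule _ _ _) = ω-Like· (𝐢· N-ω) (𝐢· N-ω)
  Divergent-⟶ (ω-Like· M-ω N-ω) (appˡ _ r) = ω-Like· (ω-Like-⟶ M-ω r) N-ω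
  Divergent-⟶ (ω-Like· M-ω N-ω) (appʳ _ r) = ω-Like· M-ω (ω-Like-⟶ N-ω r)
  Divergent-⟶ 𝐝· (s-rule _ _ _) = ω-Like· (k· is-ω) (k· is-ω)
  Divergent-⟶ 𝐝· (appˡ _ r) = ⊥-elim (NF⇒Normal NF-𝐝 _ r)
  Divergent-⟶ 𝐝· (appʳ _ r) = 𝐝·
  Divergent-⟶ (var· M-div) (appʳ _ r) = var· (Divergent-⟶ M-div r)

  Divergent⇒¬Normal : Divergent M → ¬ Normal M
  Divergent⇒¬Normal (ω-Like· is-ω N-ω) M-normal = M-normal _ (s-rule 𝐢 𝐢 _)
  Divergent⇒¬Normal (ω-Like· (𝐢· _) _) M-normal = M-normal _ (appˡ _ (s-rule k k _))
  Divergent⇒¬Normal (ω-Like· (k· _) _) M-normal = M-normal _ (appˡ _ (k-rule _ _))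
  Divergent⇒¬Normal 𝐝· M-normal = M-normal _ (s-rule _ _ _)
  Divergent⇒¬Normal (var· M-div) M-normal =
    Divergent⇒¬Normal M-div (λ _ r → M-normal _ (appʳ _ r))

  Divergent⇒¬normalisable : Divergent M → M ⟶* W → ¬ Normal W
  Divergent⇒¬normalisable M-div ε = Divergent⇒¬Normal M-div
  Divergent⇒¬normalisable M-div (r ◅ rs) =
    Divergent⇒¬normalisable (Divergent-⟶ M-div r) rs

  Functional : (X → Tm → Set) → Set
  Functional ρ = ∀ {x N N′} → ρ x N → ρ x N′ → N ≡ N′

  -- Substitutions are relations, as equality on X need not be decidable.
  module _ (ρ : X → Tm → Set) where

    data Subst : Tm → Tm → Set where
      var : ρ x N → Subst (var x) N
      s : Subst s s
      k : Subst k k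
      app : Subst M M′ → Subst N N′ → Subst (M · N) (M′ · N′)

    Subst-⟶ : Subst M N → M ⟶ M′ → ∃ λ N′ → N ⟶ N′ × Subst M′ N′
    Subst-⟶ (app (app (app s x) y) z) (s-rule _ _ _) =
      -, s-rule _ _ _ , app (app x z) (app y z)
    Subst-⟶ (app (app k x) _) (k-rule _ _) = -, k-rule _ _ , x
    Subst-⟶ (app M↦ N↦) (appˡ _ r) with Subst-⟶ M↦ r
    ... | _ , r′ , M′↦ = -, appˡ _ r′ , app M′↦ N↦
    Subst-⟶ (app M↦ N↦) (appʳ _ r) with Subst-⟶ N↦ r
    ... | _ , r′ , N′↦ = -, appʳ _ r′ , app M↦ N′↦

    Subst-⟶* : Subst M N → M ⟶* M′ → ∃ λ N′ → N ⟶* N′ × Subst M′ N′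
    Subst-⟶* M↦ ε = -, ε , M↦
    Subst-⟶* M↦ (r ◅ rs) with Subst-⟶ M↦ r
    ... | _ , r′ , M₁↦ with Subst-⟶* M₁↦ rs
    ... | _ , rs′ , M′↦ = -, r′ ◅ rs′ , M′↦

    Subst-functional : Functional ρ → Subst M N → Subst M N′ → N ≡ N′
    Subst-functional ρ-fun (var p) (var q) = ρ-fun p q
    Subst-functional ρ-fun s s = refl
    Subst-functional ρ-fun k k = refl
    Subst-functional ρ-fun (app p q) (app p′ q′) =
      cong₂ _·_ (Subst-functional ρ-fun p p′) (Subst-functional ρ-fun q q′)

    Subst-id : (∀ {x} → Occurs x M → ρ x (var x)) → Subst M M
    Subst-id {var x} fixed = var (fixed here)
    Subst-id {s} _ = s
    Subst-id {k} _ = k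
    Subst-id {M · N} fixed =
      app (Subst-id (λ o → fixed (inˡ N o))) (Subst-id (λ o → fixed (inʳ M o)))

    ⟶*-Subst : Functional ρ → M ⟶* M′ → Subst M N → Subst M′ N′ → N ⟶* N′
    ⟶*-Subst ρ-fun M⟶*M′ M↦N M′↦N′ with Subst-⟶* M↦N M⟶*M′
    ... | _ , N⟶* , M′↦ rewrite Subst-functional ρ-fun M′↦N′ M′↦ = N⟶*

  idˢ : X → Tm → Set
  idˢ x N = N ≡ var x

  idˢ-functional : Functional idˢ
  idˢ-functional p q = trans p (sym q)

  data _[_↦_] (ρ : X → Tm → Set) (a : X) (P : Tm) (x : X) : Tm → Set where
    updated : x ≡ a → (ρ [ a ↦ P ]) x P
    kept : x ≢ a → ρ x N → (ρ [ a ↦ P ]) x N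

  [↦]-functional : ∀ {ρ a} → Functional ρ → Functional (ρ [ a ↦ P ])
  [↦]-functional _ (updated _) (updated _) = refl
  [↦]-functional _ (updated x≡a) (kept x≢a _) = ⊥-elim (x≢a x≡a)
  [↦]-functional _ (kept x≢a _) (updated x≡a) = ⊥-elim (x≢a x≡a)
  [↦]-functional ρ-fun (kept _ p) (kept _ q) = ρ-fun p q

  ⟦_⟧ : Exp App → Tm
  ⟦ ⌜ M ⌝ ⟧ = M
  ⟦ e₁ ∙ e₂ ⟧ = ⟦ e₁ ⟧ · ⟦ e₂ ⟧

  Eval-⟶* : ∀ {e} → Eval App e M → ⟦ e ⟧ ⟶* M
  Eval-⟶* (ev-const _) = ε
  Eval-⟶* (ev-app e₁⇓ e₂⇓ ((r , _) , _)) = ⟶*-app (Eval-⟶* e₁⇓) (Eval-⟶* e₂⇓) ◅◅ r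

  Eval-∙⇒InN′ : ∀ {e₁ e₂} → Eval App (e₁ ∙ e₂) M → InN′ M
  Eval-∙⇒InN′ (ev-app _ _ (_ , M∈N′)) = M∈N′

  IsS : Tm → Set
  IsS t = ∀ P Q R → t · P · Q · R ⟶* P · R · (Q · R)

  ∉-var : ∀ {y} → ¬ Occurs x (var y) → x ≢ y
  ∉-var x∉y refl = x∉y here

  ∉-·ˡ : ¬ Occurs x (M · N) → ¬ Occurs x M
  ∉-·ˡ x∉MN o = x∉MN (inˡ _ o)

  ∉-·ʳ : ¬ Occurs x (M · N) → ¬ Occurs x N
  ∉-·ʳ x∉MN o = x∉MN (inʳ _ o)

  IsS-from-variables : ∀ {t a b c} → ¬ Occurs a t → ¬ Occurs b t → ¬ Occurs c t →
                       b ≢ a → c ≢ a → c ≢ b →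
                       t · var a · var b · var c ⟶* var a · var c · (var b · var c) → IsS t
  IsS-from-variables {t} {a} {b} {c} a∉t b∉t c∉t b≢a c≢a c≢b tabc⟶* P Q R =
    ⟶*-Subst ρ ρ-functional tabc⟶*
      (app (app (app (Subst-id ρ fixed) a↦P) b↦Q) c↦R) (app (app a↦P c↦R) (app b↦Q c↦R))
    where
      ρ : X → Tm → Set
      ρ = idˢ [ c ↦ R ] [ b ↦ Q ] [ a ↦ P ]

      ρ-functional : Functional ρ
      ρ-functional = [↦]-functional ([↦]-functional ([↦]-functional idˢ-functional))

      a↦P : Subst ρ (var a) P
      a↦P = var (updated refl)

      b↦Q : Subst ρ (var b) Q
      b↦Q = var (kept b≢a (updated refl))

      c↦R : Subst ρ (var c) R
      c↦R = var (kept c≢a (kept c≢b (updated refl)))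

      fixed : ∀ {x} → Occurs x t → ρ x (var x)
      fixed x∈t = kept (outside a∉t) (kept (outside b∉t) (kept (outside c∉t) refl))
        where
          outside : ∀ {y} → ¬ Occurs y t → _ ≢ y
          outside y∉t refl = y∉t x∈t

  module _ {t u : Tm} (pca : IsPCA App InN′ t u) where
    open IsPCA pca using (ax1)

    S-⟶*-variables : ∀ a b c → t · var a · var b · var c ⟶* var a · var c · (var b · var c)
    S-⟶*-variables a b c =
      Eval-⟶* (proj₂ (ax1 (var a) (var b) (var c) var∈N′ var∈N′ var∈N′ _) acbc⇓)
      where
        var∈N′ : ∀ {x} → InN′ (var x)
        var∈N′ = inj₁ (Ne⇒InL var)

        acbc⇓ : Eval App (⌜ var a ⌝ ∙ ⌜ var c ⌝ ∙ (⌜ var b ⌝ ∙ ⌜ var c ⌝))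
                         (var a · var c · (var b · var c))
        acbc⇓ = ev-app (ev-app (ev-const _) (ev-const _) (Ne-*′ var (ne var)))
                       (ev-app (ev-const _) (ev-const _) (Ne-*′ var (ne var)))
                       (Ne-*′ (app var (ne var)) (ne (app var (ne var))))

    IsPCA⇒IsS : Infinite X → ¬ ¬ IsS t
    IsPCA⇒IsS inf ¬S =
      fresh inf t λ (a , a∉t) →
      fresh inf (t · var a) λ (b , b∉ta) →
      fresh inf (t · var a · var b) λ (c , c∉tab) →
      ¬S (IsS-from-variables a∉t (∉-·ˡ b∉ta) (∉-·ˡ (∉-·ˡ c∉tab))
            (∉-var (∉-·ʳ b∉ta)) (∉-var (∉-·ʳ (∉-·ˡ c∉tab))) (∉-var (∉-·ʳ c∉tab))
            (S-⟶*-variables a b c))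

  normalisable⇒¬Divergent-reduct : M ⟶* W → Normal W → M ⟶* A → ¬ Divergent A
  normalisable⇒¬Divergent-reduct M⟶*W W-normal M⟶*A A-div =
    Divergent⇒¬normalisable A-div (⟶*-normal-form M⟶*A M⟶*W W-normal) W-normal

  IsS⇒𝐢𝐝-⟶* : ∀ {t} → IsS t → (Z : Tm) → t · 𝐢 · 𝐝 · Z ⟶* Z · (𝐝 · Z)
  IsS⇒𝐢𝐝-⟶* t-S Z = t-S 𝐢 𝐝 Z ◅◅ ⟶*-appˡ _ (𝐢-⟶* Z)

  IsS⇒𝐢𝐝∉N′ : ∀ {t} → Infinite X → IsS t → t · 𝐢 · 𝐝 ⟶* V → ¬ InN′ V
  IsS⇒𝐢𝐝∉N′ _ t-S t𝐢𝐝⟶*𝐝 (inj₂ refl) =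
    normalisable⇒¬Divergent-reduct
      (IsS⇒𝐢𝐝-⟶* t-S (k · k) ◅◅ k-rule k _ ◅ ε) (NF⇒Normal k₀) (⟶*-appˡ _ t𝐢𝐝⟶*𝐝) 𝐝·
  IsS⇒𝐢𝐝∉N′ inf t-S t𝐢𝐝⟶*V (inj₁ V∈L) = fresh inf _ λ (c , c∉V) →
    let (W , Vc⟶*W , W-normal) = proj₂ V∈L c c∉V
    in normalisable⇒¬Divergent-reduct
         (⟶*-appˡ _ t𝐢𝐝⟶*V ◅◅ Vc⟶*W) W-normal (IsS⇒𝐢𝐝-⟶* t-S (var c)) (var· 𝐝·)

proposition5p3 : (X : Set) → Infinite X →
    ¬ Σ (Term {X}) (λ t → Σ (Term {X}) (λ u →
        IsPCA (_*′_⇓_ {X}) (InN′ {X}) t u))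
proposition5p3 X inf (t , u , pca) = IsPCA⇒IsS pca inf λ t-S →
  let (V , t𝐢𝐝⇓V) = IsPCA.ax0 pca 𝐢 𝐝 (inj₁ 𝐢∈L) (inj₂ refl)
  in IsS⇒𝐢𝐝∉N′ inf t-S (Eval-⟶* t𝐢𝐝⇓V) (Eval-∙⇒InN′ t𝐢𝐝⇓V)
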